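{- Let $r,n$ be positive integers and $\lambda,\mu\in\mathrm{Par}_r(n)$ with $\lambda$ dominating $\mu$. Suppose one of $\lambda,\mu$ is rectangular (all its nonzero parts are equal) and the other has exactly two distinct nonzero part sizes. Then the point $(\lambda,\mu)\in\mathbb{R}^{2r}$ lies on a $2$-dimensional face of the $r$-Kostka cone $\mathcal{K}_r$.
   Context: For a positive integer $r$, a partition with at most $r$ parts is written as a non-increasing $r$-tuple of nonnegative integers; $\mathrm{Par}_r(n)$ is the set of such tuples with entries summing to $n$. For $\lambda,\mu\in\mathrm{Par}_r(n)$, $\lambda$ dominates $\mu$ if $\sum_{i=1}^k\lambda_i\ge\sum_{i=1}^k\mu_i$ for all $k\le r$. The $r$-Kostka cone $\mathcal{K}_r\subseteq\mathbb{R}^{2r}$ is the convex hull of all points $(\lambda_1,\dots,\lambda_r,\mu_1,\dots,\mu_r)$ with $\lambda,\mu\in\mathrm{Par}_r(n)$ for some $n$ and $\lambda$ dominating $\mu$; it is a pointed $(2r-1)$-dimensional polyhedral cone.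
   Formalization: The cone $\mathcal{K}_r$, its faces and their dimension are taken over ℚ^(2r) in place of $\mathbb{R}^{2r}$, with rational convex coefficients, rational points and a rational defining inequality for each face. -}

module Defs where

open import Data.Nat as ℕ using (ℕ; zero; suc)
open import Data.Fin using (Fin; zero; suc; splitAt; toℕ)
open import Data.Sum using (_⊎_; inj₁; inj₂; [_,_]′)
open import Data.Product using (Σ; ∃; _×_; _,_)
open import Data.Rational as ℚ using (ℚ; 0ℚ; 1ℚ)
open import Data.Integer using (+_)
open import Relation.Binary.PropositionalEquality using (_≡_; _≢_)
open import Relation.Nullary using (¬_)

-- A partition with at most r parts: a function Fin r → ℕ.
Tuple : ℕ → Set
Tuple r = Fin r → ℕ

-- psum f k = f 0 + … + f (k-1)  (sum of the first min(k,r) entries)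
psum : ∀ {r} → Tuple r → ℕ → ℕ
psum {zero}  f k       = 0
psum {suc r} f zero    = 0
psum {suc r} f (suc k) = f zero ℕ.+ psum (λ i → f (suc i)) k

Par : (r n : ℕ) → Tuple r → Set
Par r n l = (∀ (i j : Fin r) → toℕ i ℕ.≤ toℕ j → l j ℕ.≤ l i) × (psum l r ≡ n)

Dominates : ∀ {r} → Tuple r → Tuple r → Set
Dominates {r} l m = ∀ k → k ℕ.≤ r → psum m k ℕ.≤ psum l k

Rectangular : ∀ {r} → Tuple r → Set
Rectangular {r} l = ∀ (i j : Fin r) → l i ≢ 0 → l j ≢ 0 → l i ≡ l j

TwoPartSizes : ∀ {r} → Tuple r → Set
TwoPartSizes {r} l =
  Σ ℕ λ a → Σ ℕ λ b →
    (a ≢ b) × (a ≢ 0) × (b ≢ 0)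
    × (∃ λ (i : Fin r) → l i ≡ a) × (∃ λ (j : Fin r) → l j ≡ b)
    × (∀ (i : Fin r) → l i ≢ 0 → (l i ≡ a) ⊎ (l i ≡ b))

Pt : ℕ → Set
Pt d = Fin d → ℚ

ofℕ : ℕ → ℚ
ofℕ n = (+ n) ℚ./ 1

point : ∀ {r} → Tuple r → Tuple r → Pt (r ℕ.+ r)
point {r} l m i = [ (λ j → ofℕ (l j)) , (λ j → ofℕ (m j)) ]′ (splitAt r i)

qsum : ∀ {k} → (Fin k → ℚ) → ℚ
qsum {zero}  f = 0ℚ
qsum {suc k} f = f zero ℚ.+ qsum (λ i → f (suc i))

dot : ∀ {d} → Pt d → Pt d → ℚ
dot c x = qsum (λ i → c i ℚ.* x i)

IsGen : (r : ℕ) → Pt (r ℕ.+ r) → Set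
IsGen r x = Σ ℕ λ n → Σ (Tuple r) λ l → Σ (Tuple r) λ m →
  Par r n l × Par r n m × Dominates l m × (∀ i → x i ≡ point l m i)

InKostka : (r : ℕ) → Pt (r ℕ.+ r) → Set
InKostka r x = Σ ℕ λ k → Σ (Fin k → ℚ) λ a → Σ (Fin k → Pt (r ℕ.+ r)) λ g →
  (∀ j → 0ℚ ℚ.≤ a j) × (qsum a ≡ 1ℚ) × (∀ j → IsGen r (g j))
  × (∀ i → x i ≡ qsum (λ j → a j ℚ.* g j i))

LinIndep : ∀ {d k} → (Fin k → Pt d) → Set
LinIndep {d} {k} v = ∀ (a : Fin k → ℚ) →
  (∀ (i : Fin d) → qsum (λ j → a j ℚ.* v j i) ≡ 0ℚ) → ∀ j → a j ≡ 0ℚ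

AffIndep : ∀ {d k} → (Fin (suc k) → Pt d) → Set
AffIndep p = LinIndep (λ j i → p (suc j) i ℚ.- p zero i)

HasDim : ∀ {d} → (Pt d → Set) → ℕ → Set
HasDim {d} S e =
  (Σ (Fin (suc e) → Pt d) λ p → (∀ j → S (p j)) × AffIndep p)
  × (∀ (p : Fin (suc (suc e)) → Pt d) → (∀ j → S (p j)) → ¬ AffIndep p)

FaceOf : (r : ℕ) → Pt (r ℕ.+ r) → ℚ → Pt (r ℕ.+ r) → Set
FaceOf r c δ x = InKostka r x × (dot c x ≡ δ)

OnFaceOfDim : (r : ℕ) → ℕ → Pt (r ℕ.+ r) → Set
OnFaceOfDim r e x = Σ (Pt (r ℕ.+ r)) λ c → Σ ℚ λ δ →
  (∀ y → InKostka r y → δ ℚ.≤ dot c y)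
  × FaceOf r c δ x
  × HasDim (FaceOf r c δ) e

{-# OPTIONS --safe #-}
module Submission where

-- Say λ = (p^a) is the rectangle and μ = (q^b, s^c) with q ≠ s; the other case is symmetric.
-- The functional  c(λ, μ) = (λ₁ − λ_a + λ_{a+1}) + (μ₁ − μ_b + μ_{b+1} − μ_{b+c} + μ_{b+c+1})
-- is a sum of differences along non-increasing sequences, hence nonnegative on the Kostka cone,
-- and it vanishes on a generator exactly when its partitions have the shapes (p'^a) and
-- (q'^b, s'^c). Equal sizes, a·p' = b·q' + c·s', make every point of this face a linear function
-- of its two coordinates μ₁ and μ_{b+1}, so the face has dimension at most 2. It contains 0,
-- (λ, μ) and the generator pairing ((b+c)^a) with (a^(b+c)), in the order allowed by dominance;
-- their coordinates (q, s) and (a, a) are independent because q ≠ s.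

open import Defs
open import Data.Nat using (ℕ; _<_)
open import Data.Sum using (_⊎_)
open import Data.Product using (_×_)
open import Data.Nat using (zero; suc; z≤n; s≤s; z<s; s<s; _<?_; _≟_)
open import Data.Fin using (Fin; zero; suc; toℕ; fromℕ<; splitAt; _↑ˡ_; _↑ʳ_)
import Data.Fin.Properties as Finₚ
open import Data.Product using (Σ; ∃; ∃-syntax; ∃₂; _,_; proj₁; proj₂)
open import Data.Sum using (inj₁; inj₂)
open import Data.Empty using (⊥-elim)
open import Function using (_∘_)
open import Relation.Nullary using (¬_; yes; no; contradiction)
open import Relation.Unary using (Decidable)
open import Relation.Binary.PropositionalEquality
import Data.Rational as ℚ
open import Data.Rational using (ℚ; 0ℚ; 1ℚ)
import Data.Rational.Properties as ℚₚ
import Algebra.Properties.Group as GroupProperties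

module _ where
  open import Data.Nat using (_+_; _*_; _∸_; _≤_; _⊓_)
  open import Data.Nat.Properties
  open import Data.Nat.ListAction using (sum)
  open import Data.List using (List; []; _∷_; map; zipWith; length)
  import Data.List.Properties as Listₚ

  Antitone : (ℕ → ℕ) → Set
  Antitone g = ∀ {i j} → i ≤ j → g j ≤ g i

  shift : ℕ → (ℕ → ℕ) → ℕ → ℕ
  shift d g j = g (d + j)

  antitone-shift : ∀ {g} d → Antitone g → Antitone (shift d g)
  antitone-shift d anti i≤j = anti (+-monoʳ-≤ d i≤j)

  antitone-vanish : ∀ {g k} → Antitone g → g k ≡ 0 → ∀ {j} → k ≤ j → g j ≡ 0
  antitone-vanish {g} anti gk≡0 {j} k≤j = n≤0⇒n≡0 (subst (g j ≤_) gk≡0 (anti k≤j))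

  least-¬ : ∀ (P : ℕ → Set) → Decidable P → ∀ k → ¬ P k →
    ∃[ a ] a ≤ k × ¬ P a × (∀ i → i < a → P i)
  least-¬ P P? k ¬Pk with P? 0
  ... | no ¬P0 = 0 , z≤n , ¬P0 , λ _ ()
  least-¬ P P? zero    ¬Pk | yes P0 = ⊥-elim (¬Pk P0)
  least-¬ P P? (suc k) ¬Pk | yes P0 with least-¬ (P ∘ suc) (P? ∘ suc) k ¬Pk
  ... | a , a≤k , ¬Pa , below = suc a , s≤s a≤k , ¬Pa , λ where
    zero    _         → P0
    (suc i) (s≤s i<a) → below i i<a

  HasLength : (ℕ → ℕ) → ℕ → Set
  HasLength g w = (∀ j → j < w → 0 < g j) × (∀ {j} → w ≤ j → g j ≡ 0)

  antitone⇒length : ∀ {g} r → Antitone g → g r ≡ 0 → ∃[ w ] w ≤ r × HasLength g w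
  antitone⇒length {g} r anti gr≡0
    with least-¬ (λ i → 0 < g i) (λ i → 0 <? g i) r (λ 0<gr → <⇒≢ 0<gr (sym gr≡0))
  ... | w , w≤r , ¬0<gw , below = w , w≤r , below , antitone-vanish anti (n≤0⇒n≡0 (≮⇒≥ ¬0<gw))

  ≤∧≤∧+≡⇒≡ : ∀ {u v x y} → u ≤ x → v ≤ y → x + y ≡ u + v → x ≡ u × y ≡ v
  ≤∧≤∧+≡⇒≡ {u} {v} {x} {y} u≤x v≤y eq = x≡u , +-cancelˡ-≡ u y v (trans (cong (_+ y) (sym x≡u)) eq)
    where
    x≡u : x ≡ u
    x≡u = ≤-antisym (+-cancelʳ-≤ v x u (≤-trans (+-monoʳ-≤ x v≤y) (≤-reflexive eq))) u≤x

  ≢∧≢⇒≡ : ∀ {α β x y z : ℕ} → x ≡ α ⊎ x ≡ β → y ≡ α ⊎ y ≡ β → z ≡ α ⊎ z ≡ β →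
    x ≢ y → x ≢ z → y ≡ z
  ≢∧≢⇒≡ (inj₁ refl) (inj₁ refl) _           x≢y _   = ⊥-elim (x≢y refl)
  ≢∧≢⇒≡ (inj₁ refl) _           (inj₁ refl) _   x≢z = ⊥-elim (x≢z refl)
  ≢∧≢⇒≡ (inj₁ refl) (inj₂ refl) (inj₂ refl) _   _   = refl
  ≢∧≢⇒≡ (inj₂ refl) (inj₂ refl) _           x≢y _   = ⊥-elim (x≢y refl)
  ≢∧≢⇒≡ (inj₂ refl) _           (inj₂ refl) _   x≢z = ⊥-elim (x≢z refl)
  ≢∧≢⇒≡ (inj₂ refl) (inj₁ refl) (inj₁ refl) _   _   = refl

  partialSum : (ℕ → ℕ) → ℕ → ℕ
  partialSum g zero    = 0
  partialSum g (suc k) = g 0 + partialSum (shift 1 g) k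

  partialSum-zero : ∀ {g} k → (∀ j → g j ≡ 0) → partialSum g k ≡ 0
  partialSum-zero zero    g≡0 = refl
  partialSum-zero (suc k) g≡0 = cong₂ _+_ (g≡0 0) (partialSum-zero k (g≡0 ∘ suc))

  partialSum-+ : ∀ g d k → partialSum g (d + k) ≡ partialSum g d + partialSum (shift d g) k
  partialSum-+ g zero    k = refl
  partialSum-+ g (suc d) k =
    trans (cong (g 0 +_) (partialSum-+ (shift 1 g) d k)) (sym (+-assoc (g 0) _ _))

  partialSum-const : ∀ {g x} d → (∀ j → j < d → g j ≡ x) → partialSum g d ≡ d * x
  partialSum-const zero    _   = refl
  partialSum-const (suc d) g≡x =
    cong₂ _+_ (g≡x 0 z<s) (partialSum-const d (λ j j<d → g≡x (suc j) (s<s j<d)))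

  partialSum-mono : ∀ g {k k'} → k ≤ k' → partialSum g k ≤ partialSum g k'
  partialSum-mono g {k} k≤k' with m≤n⇒∃[o]m+o≡n k≤k'
  ... | o , refl = ≤-trans (m≤m+n _ _) (≤-reflexive (sym (partialSum-+ g k o)))

  partialSum-suc : ∀ g k → partialSum g (suc k) ≡ partialSum g k + g k
  partialSum-suc g zero    = +-comm (g 0) 0
  partialSum-suc g (suc k) =
    trans (cong (g 0 +_) (partialSum-suc (shift 1 g) k)) (sym (+-assoc (g 0) _ _))

  partialSum-vanish : ∀ {g K} k → Antitone g → g K ≡ 0 → K ≤ k → partialSum g k ≡ partialSum g K
  partialSum-vanish {g} {K} k anti gK≡0 K≤k with m≤n⇒∃[o]m+o≡n K≤k
  ... | o , refl = trans (partialSum-+ g K o)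
    (trans (cong (partialSum g K +_) (partialSum-zero o (λ j → antitone-vanish anti gK≡0 (m≤m+n K j))))
           (+-identityʳ _))

  -- Stair (d₁ ∷ … ∷ dₖ) g: g is constant on the consecutive blocks [0, d₁), [d₁, d₁ + d₂), …
  -- and vanishes after the last one.
  Stair : List ℕ → (ℕ → ℕ) → Set
  Stair []       g = ∀ j → g j ≡ 0
  Stair (d ∷ ds) g = (∀ j → j < d → g j ≡ g 0) × Stair ds (shift d g)

  Stair-cong : ∀ ds {f g} → (∀ j → f j ≡ g j) → Stair ds f → Stair ds g
  Stair-cong []       f≗g f≡0 j = trans (sym (f≗g j)) (f≡0 j)
  Stair-cong (d ∷ ds) f≗g (block , rest) =
    (λ j j<d → trans (sym (f≗g j)) (trans (block j j<d) (f≗g 0))) ,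
    Stair-cong ds (f≗g ∘ (d +_)) rest

  -- Summing g over tops minus over bottoms adds up (first − last value) over the blocks plus the
  -- value after the last block; an empty block contributes g 0 − g 0 since 0 ∸ 1 = 0.
  tops bottoms : List ℕ → List ℕ
  tops []       = 0 ∷ []
  tops (d ∷ ds) = 0 ∷ map (d +_) (tops ds)
  bottoms []       = []
  bottoms (d ∷ ds) = d ∸ 1 ∷ map (d +_) (bottoms ds)

  sumAt : (ℕ → ℕ) → List ℕ → ℕ
  sumAt g ps = sum (map g ps)

  sumAt-shift : ∀ g d ps → sumAt g (map (d +_) ps) ≡ sumAt (shift d g) ps
  sumAt-shift g d ps = cong sum (sym (Listₚ.map-∘ ps))

  bottoms≤tops : ∀ ds {g} → Antitone g → sumAt g (bottoms ds) ≤ sumAt g (tops ds)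
  bottoms≤tops []       anti = z≤n
  bottoms≤tops (d ∷ ds) {g} anti
    rewrite sumAt-shift g d (bottoms ds) | sumAt-shift g d (tops ds) =
    +-mono-≤ (anti z≤n) (bottoms≤tops ds (antitone-shift d anti))

  tops≡bottoms⇒Stair : ∀ ds {g} → Antitone g → sumAt g (tops ds) ≡ sumAt g (bottoms ds) → Stair ds g
  tops≡bottoms⇒Stair []       anti eq j = antitone-vanish anti (trans (sym (+-identityʳ _)) eq) z≤n
  tops≡bottoms⇒Stair (d ∷ ds) {g} anti eq
    rewrite sumAt-shift g d (bottoms ds) | sumAt-shift g d (tops ds)
    with ≤∧≤∧+≡⇒≡ (anti z≤n) (bottoms≤tops ds (antitone-shift d anti)) eq
  ... | g0≡gd , rest = block d g0≡gd , tops≡bottoms⇒Stair ds (antitone-shift d anti) rest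
    where
    block : ∀ d → g 0 ≡ g (d ∸ 1) → ∀ j → j < d → g j ≡ g 0
    block (suc d) g0≡gd j (s≤s j≤d) = ≤-antisym (anti z≤n) (subst (_≤ g j) (sym g0≡gd) (anti j≤d))

  Stair⇒tops≡bottoms : ∀ ds {g} → Stair ds g → sumAt g (tops ds) ≡ sumAt g (bottoms ds)
  Stair⇒tops≡bottoms []       g≡0 = cong (_+ 0) (g≡0 0)
  Stair⇒tops≡bottoms (d ∷ ds) {g} (block , rest)
    rewrite sumAt-shift g d (bottoms ds) | sumAt-shift g d (tops ds) =
    cong₂ _+_ (sym (block-end d block)) (Stair⇒tops≡bottoms ds rest)
    where
    block-end : ∀ d → (∀ j → j < d → g j ≡ g 0) → g (d ∸ 1) ≡ g 0
    block-end zero    _     = refl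
    block-end (suc d) block = block d ≤-refl

  heights : List ℕ → (ℕ → ℕ) → List ℕ
  heights []       g = []
  heights (d ∷ ds) g = g 0 ∷ heights ds (shift d g)

  partialSum-Stair : ∀ ds {g k} → Stair ds g → sum ds ≤ k →
    partialSum g k ≡ sum (zipWith _*_ ds (heights ds g))
  partialSum-Stair []       {k = k} g≡0 _ = partialSum-zero k g≡0
  partialSum-Stair (d ∷ ds) {g} (block , rest) ds≤k
    with m≤n⇒∃[o]m+o≡n (≤-trans (m≤m+n d (sum ds)) ds≤k)
  ... | o , refl = trans (partialSum-+ g d o)
    (cong₂ _+_ (partialSum-const d block) (partialSum-Stair ds rest (+-cancelˡ-≤ d _ _ ds≤k)))

  staircase : List ℕ → List ℕ → ℕ → ℕ
  staircase []           hs       j       = 0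
  staircase (d ∷ ds)     []       j       = 0
  staircase (zero ∷ ds)  (h ∷ hs) j       = staircase ds hs j
  staircase (suc d ∷ ds) (h ∷ hs) zero    = h
  staircase (suc d ∷ ds) (h ∷ hs) (suc j) = staircase (d ∷ ds) (h ∷ hs) j

  staircase-< : ∀ d ds h hs {j} → j < d → staircase (d ∷ ds) (h ∷ hs) j ≡ h
  staircase-< (suc d) ds h hs {zero}  _         = refl
  staircase-< (suc d) ds h hs {suc j} (s≤s j<d) = staircase-< d ds h hs j<d

  staircase-shift : ∀ d ds h hs j → staircase (d ∷ ds) (h ∷ hs) (d + j) ≡ staircase ds hs j
  staircase-shift zero    ds h hs j = refl
  staircase-shift (suc d) ds h hs j = staircase-shift d ds h hs j

  staircase-zipWith : ∀ (f : ℕ → ℕ → ℕ) → f 0 0 ≡ 0 → ∀ ds hs hs' → length hs ≡ length hs' → ∀ j →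
    staircase ds (zipWith f hs hs') j ≡ f (staircase ds hs j) (staircase ds hs' j)
  staircase-zipWith f f00 []           hs       hs'        _  j       = sym f00
  staircase-zipWith f f00 (d ∷ ds)     []       []         _  j       = sym f00
  staircase-zipWith f f00 (zero ∷ ds)  (h ∷ hs) (h' ∷ hs') eq j       =
    staircase-zipWith f f00 ds hs hs' (suc-injective eq) j
  staircase-zipWith f f00 (suc d ∷ ds) (h ∷ hs) (h' ∷ hs') eq zero    = refl
  staircase-zipWith f f00 (suc d ∷ ds) (h ∷ hs) (h' ∷ hs') eq (suc j) =
    staircase-zipWith f f00 (d ∷ ds) (h ∷ hs) (h' ∷ hs') eq j

  staircase-merge : ∀ d d' ds h hs j →
    staircase (d ∷ d' ∷ ds) (h ∷ h ∷ hs) j ≡ staircase (d + d' ∷ ds) (h ∷ hs) j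
  staircase-merge zero    d' ds h hs j       = refl
  staircase-merge (suc d) d' ds h hs zero    = refl
  staircase-merge (suc d) d' ds h hs (suc j) = staircase-merge d d' ds h hs j

  Stair⇒staircase : ∀ ds {g} → Stair ds g → ∀ j → g j ≡ staircase ds (heights ds g) j
  Stair⇒staircase []       g≡0 j = g≡0 j
  Stair⇒staircase (d ∷ ds) (block , rest) j with j <? d
  ... | yes j<d = trans (block j j<d) (sym (staircase-< d ds _ _ j<d))
  ... | no  j≮d with m≤n⇒∃[o]m+o≡n (≮⇒≥ j≮d)
  ...   | o , refl = trans (Stair⇒staircase ds rest o) (sym (staircase-shift d ds _ _ o))

  staircase-Stair : ∀ ds hs → length ds ≡ length hs → Stair ds (staircase ds hs)
  staircase-Stair []       []       _  j = refl
  staircase-Stair (d ∷ ds) (h ∷ hs) eq =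
    (λ j j<d → trans (staircase-< d ds h hs j<d) (sym (staircase-< d ds h hs (≤-<-trans z≤n j<d)))) ,
    Stair-cong ds (λ j → sym (staircase-shift d ds h hs j)) (staircase-Stair ds hs (suc-injective eq))

  rectangle : ℕ → ℕ → ℕ → ℕ
  rectangle a x = staircase (a ∷ []) (x ∷ [])

  rectangle-≥ : ∀ a x {j} → a ≤ j → rectangle a x j ≡ 0
  rectangle-≥ a x a≤j with m≤n⇒∃[o]m+o≡n a≤j
  ... | o , refl = staircase-shift a [] x [] o

  rectangle-antitone : ∀ a x → Antitone (rectangle a x)
  rectangle-antitone a x {i} {j} i≤j with j <? a
  ... | yes j<a = ≤-reflexive (trans (staircase-< a [] x [] j<a) (sym (staircase-< a [] x [] (≤-<-trans i≤j j<a))))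
  ... | no  j≮a = subst (_≤ rectangle a x i) (sym (rectangle-≥ a x (≮⇒≥ j≮a))) z≤n

  partialSum-rectangle : ∀ a x k → partialSum (rectangle a x) k ≡ (a ⊓ k) * x
  partialSum-rectangle zero    x k       = partialSum-zero k (λ _ → refl)
  partialSum-rectangle (suc a) x zero    = refl
  partialSum-rectangle (suc a) x (suc k) = cong (x +_) (partialSum-rectangle a x k)

  partialSum-rectangle-≤ : ∀ {a B} k → a ≤ B → partialSum (rectangle B a) k ≤ partialSum (rectangle a B) k
  partialSum-rectangle-≤ {a} {B} k a≤B = begin
    partialSum (rectangle B a) k ≡⟨ partialSum-rectangle B a k ⟩
    (B ⊓ k) * a                  ≡⟨ *-distribʳ-⊓ a B k ⟩
    (B * a) ⊓ (k * a)            ≤⟨ ⊓-mono-≤ (≤-reflexive (*-comm B a)) (*-monoʳ-≤ k a≤B) ⟩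
    (a * B) ⊓ (k * B)            ≡⟨ *-distribʳ-⊓ B a k ⟨
    (a ⊓ k) * B                  ≡⟨ partialSum-rectangle a B k ⟨
    partialSum (rectangle a B) k ∎
    where open ≤-Reasoning

  -- parts l k is the (k+1)-st part of l, padded with zeros beyond r.
  parts : ∀ {r} → Tuple r → ℕ → ℕ
  parts {zero}  l k       = 0
  parts {suc r} l zero    = l zero
  parts {suc r} l (suc k) = parts (l ∘ suc) k

  parts-toℕ : ∀ {r} (l : Tuple r) J → parts l (toℕ J) ≡ l J
  parts-toℕ l zero    = refl
  parts-toℕ l (suc J) = parts-toℕ (l ∘ suc) J

  parts-fromℕ< : ∀ {r} (l : Tuple r) {k} (k<r : k < r) → parts l k ≡ l (fromℕ< k<r)
  parts-fromℕ< l k<r = trans (cong (parts l) (sym (Finₚ.toℕ-fromℕ< k<r))) (parts-toℕ l _)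

  parts-≥ : ∀ {r} (l : Tuple r) {k} → r ≤ k → parts l k ≡ 0
  parts-≥ {zero}  l         _         = refl
  parts-≥ {suc r} l {suc k} (s≤s r≤k) = parts-≥ (l ∘ suc) r≤k

  parts-nonzero : ∀ {r} (l : Tuple r) {k} → parts l k ≢ 0 → Σ (Fin r) λ J → parts l k ≡ l J
  parts-nonzero {r} l {k} lk≢0 with k <? r
  ... | yes k<r = fromℕ< k<r , parts-fromℕ< l k<r
  ... | no  k≮r = contradiction (parts-≥ l (≮⇒≥ k≮r)) lk≢0

  parts-tabulate : ∀ {r} g → (∀ {j} → r ≤ j → g j ≡ 0) → ∀ j → parts {r} (g ∘ toℕ) j ≡ g j
  parts-tabulate {zero}  g g≡0 j       = sym (g≡0 z≤n)
  parts-tabulate {suc r} g g≡0 zero    = refl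
  parts-tabulate {suc r} g g≡0 (suc j) = parts-tabulate (shift 1 g) (λ r≤j → g≡0 (s≤s r≤j)) j

  psum≡partialSum : ∀ {r} (l : Tuple r) k → psum l k ≡ partialSum (parts l) k
  psum≡partialSum {zero}  l k       = sym (partialSum-zero k (λ _ → refl))
  psum≡partialSum {suc r} l zero    = refl
  psum≡partialSum {suc r} l (suc k) = cong (l zero +_) (psum≡partialSum (l ∘ suc) k)

  psum-tabulate : ∀ {r} g {k} → k ≤ r → psum {r} (g ∘ toℕ) k ≡ partialSum g k
  psum-tabulate {zero}  g         z≤n       = refl
  psum-tabulate {suc r} g {zero}  _         = refl
  psum-tabulate {suc r} g {suc k} (s≤s k≤r) = cong (g 0 +_) (psum-tabulate (shift 1 g) k≤r)

  module _ {r n} {l : Tuple r} (par : Par r n l) where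

    Par⇒antitone : Antitone (parts l)
    Par⇒antitone {i} {j} i≤j with j <? r
    ... | no  j≮r = subst (_≤ parts l i) (sym (parts-≥ l (≮⇒≥ j≮r))) z≤n
    ... | yes j<r = subst₂ _≤_ (sym (parts-fromℕ< l j<r)) (sym (parts-fromℕ< l i<r))
        (proj₁ par _ _ (subst₂ _≤_ (sym (Finₚ.toℕ-fromℕ< i<r)) (sym (Finₚ.toℕ-fromℕ< j<r)) i≤j))
      where
      i<r : i < r
      i<r = ≤-<-trans i≤j j<r

    Par⇒partialSum : partialSum (parts l) r ≡ n
    Par⇒partialSum = trans (sym (psum≡partialSum l r)) (proj₂ par)

  tabulate-Par : ∀ {r n g} → Antitone g → partialSum g r ≡ n → Par r n (g ∘ toℕ)
  tabulate-Par {r} {g = g} anti sum≡n = (λ I J I≤J → anti I≤J) , trans (psum-tabulate {r} g ≤-refl) sum≡n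

  dominates⇒vanish : ∀ {r n} {l m : Tuple r} → Par r n l → Par r n m → Dominates l m →
    ∀ {K} → parts m K ≡ 0 → parts l K ≡ 0
  dominates⇒vanish {r} {n} {l} {m} pl pm dom {K} mK≡0 with K <? r
  ... | no  K≮r = parts-≥ l (≮⇒≥ K≮r)
  ... | yes K<r = n≤0⇒n≡0 (+-cancelˡ-≤ (partialSum L K) _ _ (begin
    partialSum L K + L K         ≡⟨ partialSum-suc L K ⟨
    partialSum L (suc K)         ≤⟨ partialSum-mono L K<r ⟩
    partialSum L r               ≡⟨ Par⇒partialSum pl ⟩
    n                            ≡⟨ Par⇒partialSum pm ⟨
    partialSum M r               ≡⟨ partialSum-vanish r (Par⇒antitone pm) mK≡0 (<⇒≤ K<r) ⟩
    partialSum M K               ≡⟨ psum≡partialSum m K ⟨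
    psum m K                     ≤⟨ dom K (<⇒≤ K<r) ⟩
    psum l K                     ≡⟨ psum≡partialSum l K ⟩
    partialSum L K               ≡⟨ +-identityʳ _ ⟨
    partialSum L K + 0           ∎))
    where
    open ≤-Reasoning
    L M : ℕ → ℕ
    L = parts l
    M = parts m

  dominates⇒length≤ : ∀ {r n} {l m : Tuple r} → Par r n l → Par r n m → Dominates l m →
    ∀ {A B} → HasLength (parts l) A → HasLength (parts m) B → A ≤ B
  dominates⇒length≤ pl pm dom {A} {B} (l-pos , _) (_ , m-zero) =
    ≮⇒≥ λ B<A → >⇒≢ (l-pos B B<A) (dominates⇒vanish pl pm dom (m-zero ≤-refl))

  rectangle-Dominates : ∀ {r a B} → a ≤ B → Dominates {r} (rectangle a B ∘ toℕ) (rectangle B a ∘ toℕ)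
  rectangle-Dominates {a = a} {B} a≤B k k≤r =
    subst₂ _≤_ (sym (psum-tabulate (rectangle B a) k≤r)) (sym (psum-tabulate (rectangle a B) k≤r))
      (partialSum-rectangle-≤ k a≤B)

  rectangle-Par : ∀ {r} a x → a ≤ r → Par r (a * x) (rectangle a x ∘ toℕ)
  rectangle-Par {r} a x a≤r =
    tabulate-Par (rectangle-antitone a x) (trans (partialSum-rectangle a x r) (cong (_* x) (m≤n⇒m⊓n≡m a≤r)))

  parts-rectangle : ∀ {r} a x → a ≤ r → ∀ j → parts {r} (rectangle a x ∘ toℕ) j ≡ rectangle a x j
  parts-rectangle a x a≤r = parts-tabulate (rectangle a x) (λ r≤j → rectangle-≥ a x (≤-trans a≤r r≤j))

  partialSum-positive⇒head : ∀ {g} k → Antitone g → 0 < partialSum g k → 0 < g 0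
  partialSum-positive⇒head {g} k anti 0<sum with g 0 ≟ 0
  ... | no  g0≢0 = n≢0⇒n>0 g0≢0
  ... | yes g0≡0 = contradiction (partialSum-zero k (λ j → antitone-vanish anti g0≡0 z≤n)) (>⇒≢ 0<sum)

  module _ {g : ℕ → ℕ} {r : ℕ} (anti : Antitone g) (gr≡0 : g r ≡ 0) where

    rectangular⇒Stair : 0 < g 0 → (∀ i j → g i ≢ 0 → g j ≢ 0 → g i ≡ g j) →
      ∃[ a ] 0 < a × a ≤ r × HasLength g a × Stair (a ∷ []) g
    rectangular⇒Stair 0<g0 rect with antitone⇒length r anti gr≡0
    ... | zero  , _   , _   , zeroFrom = contradiction (zeroFrom z≤n) (>⇒≢ 0<g0)
    ... | suc a , a<r , pos , zeroFrom =
      suc a , z<s , a<r , (pos , zeroFrom) ,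
      (λ j j≤a → rect j 0 (>⇒≢ (pos j j≤a)) (>⇒≢ 0<g0)) ,
      (λ j → zeroFrom (m≤m+n (suc a) j))

    anotherSize : ∀ {α β} → α ≢ β → α ≢ 0 → β ≢ 0 → (∃ λ i → g i ≡ α) → (∃ λ i → g i ≡ β) →
      ∃[ k ] g k ≢ 0 × g k ≢ g 0
    anotherSize {α} {β} α≢β α≢0 β≢0 (iα , giα≡α) (iβ , giβ≡β) with g 0 ≟ α
    ... | yes g0≡α =
      iβ , (λ e → β≢0 (trans (sym giβ≡β) e)) , λ e → α≢β (trans (sym g0≡α) (trans (sym e) giβ≡β))
    ... | no  g0≢α = iα , (λ e → α≢0 (trans (sym giα≡α) e)) , λ e → g0≢α (trans (sym e) giα≡α)

    twoSizes⇒Stair : ∀ {α β} → α ≢ β → α ≢ 0 → β ≢ 0 → (∃ λ i → g i ≡ α) → (∃ λ i → g i ≡ β) →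
      (∀ i → g i ≢ 0 → g i ≡ α ⊎ g i ≡ β) →
      ∃₂ λ b c → 0 < c × b + c ≤ r × HasLength g (b + c) × g 0 ≢ g b × Stair (b ∷ c ∷ []) g
    twoSizes⇒Stair {α} {β} α≢β α≢0 β≢0 (iα , giα≡α) (iβ , giβ≡β) two
      with antitone⇒length r anti gr≡0 | anotherSize α≢β α≢0 β≢0 (iα , giα≡α) (iβ , giβ≡β)
    ... | B , B≤r , pos , zeroFrom | k , gk≢0 , gk≢g0
      with least-¬ (λ i → g i ≡ g 0) (λ i → g i ≟ g 0) k gk≢g0
    ... | b , b≤k , gb≢g0 , head with m≤n⇒∃[o]m+o≡n b<B
      where
      b<B : b < B
      b<B = ≰⇒> λ B≤b → >⇒≢ (<-≤-trans (n≢0⇒n>0 gk≢0) (anti b≤k)) (zeroFrom B≤b)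
    ... | c , refl =
      b , suc c , z<s , ≤-trans (≤-reflexive (+-suc b c)) B≤r ,
      subst (HasLength g) (sym (+-suc b c)) (pos , zeroFrom) , ≢-sym gb≢g0 ,
      head , middle , tail
      where
      g0≢0 : g 0 ≢ 0
      g0≢0 = >⇒≢ (pos 0 z<s)
      middle : ∀ j → j < suc c → g (b + j) ≡ g (b + 0)
      middle j (s≤s j≤c) = trans (sym (≢∧≢⇒≡ (two 0 g0≢0) (two b gb≢0) (two (b + j) gbj≢0)
                                       (≢-sym gb≢g0) (>⇒≢ gbj<g0)))
                           (cong g (sym (+-identityʳ b)))
        where
        gbj≢0 : g (b + j) ≢ 0
        gbj≢0 = >⇒≢ (pos (b + j) (s≤s (+-monoʳ-≤ b j≤c)))
        gb≢0 : g b ≢ 0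
        gb≢0 gb≡0 = gbj≢0 (antitone-vanish anti gb≡0 (m≤m+n b j))
        gbj<g0 : g (b + j) < g 0
        gbj<g0 = ≤-<-trans (anti (m≤m+n b j)) (≤∧≢⇒< (anti z≤n) gb≢g0)
      tail : ∀ j → g (b + (suc c + j)) ≡ 0
      tail j = zeroFrom (≤-trans (≤-reflexive (sym (+-suc b c)))
                         (≤-trans (m≤m+n (b + suc c) j) (≤-reflexive (+-assoc b (suc c) j))))

  module _ {r n} {l : Tuple r} (par : Par r n l) where

    Rectangular⇒Stair : 0 < n → Rectangular l →
      ∃[ a ] 0 < a × a ≤ r × HasLength (parts l) a × Stair (a ∷ []) (parts l)
    Rectangular⇒Stair 0<n rect =
      rectangular⇒Stair (Par⇒antitone par) (parts-≥ l ≤-refl)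
        (partialSum-positive⇒head r (Par⇒antitone par) (subst (0 <_) (sym (Par⇒partialSum par)) 0<n))
        λ i j li≢0 lj≢0 → rectangular-parts li≢0 lj≢0 (parts-nonzero l li≢0) (parts-nonzero l lj≢0)
      where
      rectangular-parts : ∀ {i j} → parts l i ≢ 0 → parts l j ≢ 0 →
        Σ (Fin r) (λ I → parts l i ≡ l I) → Σ (Fin r) (λ J → parts l j ≡ l J) → parts l i ≡ parts l j
      rectangular-parts li≢0 lj≢0 (I , li≡lI) (J , lj≡lJ) =
        trans li≡lI (trans (rect I J (li≢0 ∘ trans li≡lI) (lj≢0 ∘ trans lj≡lJ)) (sym lj≡lJ))

    TwoPartSizes⇒Stair : TwoPartSizes l →
      ∃₂ λ b c → 0 < c × b + c ≤ r × HasLength (parts l) (b + c) × parts l 0 ≢ parts l b ×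
        Stair (b ∷ c ∷ []) (parts l)
    TwoPartSizes⇒Stair (α , β , α≢β , α≢0 , β≢0 , (I , lI≡α) , (J , lJ≡β) , two) =
      twoSizes⇒Stair (Par⇒antitone par) (parts-≥ l ≤-refl) α≢β α≢0 β≢0
        (toℕ I , trans (parts-toℕ l I) lI≡α) (toℕ J , trans (parts-toℕ l J) lJ≡β)
        λ i li≢0 → two-parts li≢0 (parts-nonzero l li≢0)
      where
      two-parts : ∀ {i} → parts l i ≢ 0 → Σ (Fin r) (λ I → parts l i ≡ l I) → parts l i ≡ α ⊎ parts l i ≡ β
      two-parts li≢0 (I , li≡lI) with two I (li≢0 ∘ trans li≡lI)
      ... | inj₁ lI≡α = inj₁ (trans li≡lI lI≡α)
      ... | inj₂ lI≡β = inj₂ (trans li≡lI lI≡β)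


module _ where
  import Data.Nat as ℕ
  import Data.Nat.Properties as ℕₚ
  import Data.Nat.Coprimality as Coprimality
  import Data.Integer as ℤ
  import Data.Integer.Properties as ℤₚ
  open import Data.Rational using (mkℚ; _+_; _*_; _-_; -_; _≤_)
  open import Data.Rational.Solver using (module +-*-Solver)
  open +-*-Solver using (solve; _:+_; _:*_; _:=_)
  open import Data.Vec.Functional using (_++_)
  open import Data.Vec.Functional.Properties using (lookup-++ˡ; lookup-++ʳ)
  open import Data.List using (List; []; _∷_)
  open GroupProperties ℚₚ.+-0-group using (x∙y⁻¹≈ε⇒x≈y)

  ofℕ≡mkℚ : ∀ n → ofℕ n ≡ mkℚ (ℤ.+ n) 0 (Coprimality.sym (Coprimality.1-coprimeTo n))
  ofℕ≡mkℚ n = ℚₚ.normalize-coprime (Coprimality.sym (Coprimality.1-coprimeTo n))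

  ofℕ-homo-+ : ∀ m n → ofℕ (m ℕ.+ n) ≡ ofℕ m + ofℕ n
  ofℕ-homo-+ m n = trans
    (ℚₚ./-cong (trans (ℤₚ.pos-+ m n)
                      (sym (cong₂ ℤ._+_ (ℤₚ.*-identityʳ (ℤ.+ m)) (ℤₚ.*-identityʳ (ℤ.+ n))))) refl)
    (sym (cong₂ _+_ (ofℕ≡mkℚ m) (ofℕ≡mkℚ n)))

  ofℕ-homo-* : ∀ m n → ofℕ (m ℕ.* n) ≡ ofℕ m * ofℕ n
  ofℕ-homo-* m n = trans (ℚₚ./-cong (ℤₚ.pos-* m n) refl) (sym (cong₂ _*_ (ofℕ≡mkℚ m) (ofℕ≡mkℚ n)))

  ofℕ-mono-≤ : ∀ {m n} → m ℕ.≤ n → ofℕ m ≤ ofℕ n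
  ofℕ-mono-≤ {m} {n} m≤n rewrite ofℕ≡mkℚ m | ofℕ≡mkℚ n =
    ℚ.*≤* (subst₂ ℤ._≤_ (ℤₚ.pos-* m 1) (ℤₚ.pos-* n 1) (ℤ.+≤+ (ℕₚ.*-monoˡ-≤ 1 m≤n)))

  ofℕ-injective : ∀ {m n} → ofℕ m ≡ ofℕ n → m ≡ n
  ofℕ-injective {m} {n} eq =
    ℤₚ.+-injective (cong ℚ.numerator (trans (sym (ofℕ≡mkℚ m)) (trans eq (ofℕ≡mkℚ n))))

  ofℕ-linear : ∀ A x P q Q s → A ℕ.* x ≡ P ℕ.* q ℕ.+ Q ℕ.* s →
    ofℕ A * ofℕ x ≡ ofℕ P * ofℕ q + ofℕ Q * ofℕ s
  ofℕ-linear A x P q Q s eq = begin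
    ofℕ A * ofℕ x                   ≡⟨ ofℕ-homo-* A x ⟨
    ofℕ (A ℕ.* x)                   ≡⟨ cong ofℕ eq ⟩
    ofℕ (P ℕ.* q ℕ.+ Q ℕ.* s)       ≡⟨ ofℕ-homo-+ (P ℕ.* q) (Q ℕ.* s) ⟩
    ofℕ (P ℕ.* q) + ofℕ (Q ℕ.* s)   ≡⟨ cong₂ _+_ (ofℕ-homo-* P q) (ofℕ-homo-* Q s) ⟩
    ofℕ P * ofℕ q + ofℕ Q * ofℕ s   ∎
    where open ≡-Reasoning

  ofℕ-*-cancelʳ : ∀ {q s a} → a ≢ 0 → ofℕ q * ofℕ a ≡ ofℕ s * ofℕ a → q ≡ s
  ofℕ-*-cancelʳ {q} {s} {a} a≢0 eq = ℕₚ.*-cancelʳ-≡ q s a {{ℕ.≢-nonZero a≢0}}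
    (ofℕ-injective (trans (ofℕ-homo-* q a) (trans eq (sym (ofℕ-homo-* s a)))))

  p-q≡0⇒p≡q : ∀ {p q} → p - q ≡ 0ℚ → p ≡ q
  p-q≡0⇒p≡q {p} {q} = x∙y⁻¹≈ε⇒x≈y p q

  p≤q⇒0≤q-p : ∀ {p q} → p ≤ q → 0ℚ ≤ q - p
  p≤q⇒0≤q-p {p} {q} p≤q = subst (_≤ q - p) (ℚₚ.+-inverseʳ p) (ℚₚ.+-monoˡ-≤ (- p) p≤q)

  0≤p+q : ∀ {p q} → 0ℚ ≤ p → 0ℚ ≤ q → 0ℚ ≤ p + q
  0≤p+q 0≤p 0≤q = ℚₚ.+-mono-≤ 0≤p 0≤q

  0≤p*q : ∀ {p q} → 0ℚ ≤ p → 0ℚ ≤ q → 0ℚ ≤ p * q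
  0≤p*q {p} {q} 0≤p 0≤q =
    ℚₚ.nonNegative⁻¹ _ {{ℚₚ.nonNeg*nonNeg⇒nonNeg p {{ℚ.nonNegative 0≤p}} q {{ℚ.nonNegative 0≤q}}}}

  p+q≡0⇒p≡0 : ∀ {p q} → 0ℚ ≤ p → 0ℚ ≤ q → p + q ≡ 0ℚ → p ≡ 0ℚ
  p+q≡0⇒p≡0 {p} {q} 0≤p 0≤q p+q≡0 =
    ℚₚ.≤-antisym (subst₂ _≤_ (ℚₚ.+-identityʳ p) p+q≡0 (ℚₚ.+-monoʳ-≤ p 0≤q)) 0≤p

  p+q≡0⇒q≡0 : ∀ {p q} → 0ℚ ≤ p → 0ℚ ≤ q → p + q ≡ 0ℚ → q ≡ 0ℚ
  p+q≡0⇒q≡0 {p} {q} 0≤p 0≤q p+q≡0 = p+q≡0⇒p≡0 0≤q 0≤p (trans (ℚₚ.+-comm q p) p+q≡0)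

  p*q≡0⇒q≡0 : ∀ {p q} → p ≢ 0ℚ → p * q ≡ 0ℚ → q ≡ 0ℚ
  p*q≡0⇒q≡0 {p} {q} p≢0 pq≡0 = begin
    q                  ≡⟨ ℚₚ.*-identityˡ q ⟨
    1ℚ * q             ≡⟨ cong (_* q) (ℚₚ.*-inverseˡ p) ⟨
    (ℚ.1/ p * p) * q   ≡⟨ ℚₚ.*-assoc (ℚ.1/ p) p q ⟩
    ℚ.1/ p * (p * q)   ≡⟨ cong (ℚ.1/ p *_) pq≡0 ⟩
    ℚ.1/ p * 0ℚ        ≡⟨ ℚₚ.*-zeroʳ (ℚ.1/ p) ⟩
    0ℚ                 ∎
    where
    open ≡-Reasoning
    instance
      p-nonZero : ℚ.NonZero p
      p-nonZero = ℚ.≢-nonZero p≢0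

  qsum-cong : ∀ {k} {f g : Fin k → ℚ} → (∀ i → f i ≡ g i) → qsum f ≡ qsum g
  qsum-cong {zero}  f≗g = refl
  qsum-cong {suc k} f≗g = cong₂ _+_ (f≗g zero) (qsum-cong (f≗g ∘ suc))

  qsum-zero : ∀ k → qsum {k} (λ _ → 0ℚ) ≡ 0ℚ
  qsum-zero zero    = refl
  qsum-zero (suc k) = trans (cong (0ℚ +_) (qsum-zero k)) (ℚₚ.+-identityʳ 0ℚ)

  qsum-+ : ∀ {k} (f g : Fin k → ℚ) → qsum (λ i → f i + g i) ≡ qsum f + qsum g
  qsum-+ {zero}  f g = sym (ℚₚ.+-identityʳ 0ℚ)
  qsum-+ {suc k} f g = trans (cong (f zero + g zero +_) (qsum-+ (f ∘ suc) (g ∘ suc)))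
    (solve 4 (λ a b c d → (a :+ b) :+ (c :+ d) := (a :+ c) :+ (b :+ d)) refl
       (f zero) (g zero) (qsum (f ∘ suc)) (qsum (g ∘ suc)))

  qsum-neg : ∀ {k} (f : Fin k → ℚ) → qsum (λ i → - f i) ≡ - qsum f
  qsum-neg {zero}  f = refl
  qsum-neg {suc k} f = trans (cong (- f zero +_) (qsum-neg (f ∘ suc))) (sym (ℚₚ.neg-distrib-+ (f zero) (qsum (f ∘ suc))))

  qsum-*ˡ : ∀ {k} c (f : Fin k → ℚ) → qsum (λ i → c * f i) ≡ c * qsum f
  qsum-*ˡ {zero}  c f = sym (ℚₚ.*-zeroʳ c)
  qsum-*ˡ {suc k} c f = trans (cong (c * f zero +_) (qsum-*ˡ c (f ∘ suc)))
    (sym (ℚₚ.*-distribˡ-+ c (f zero) (qsum (f ∘ suc))))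

  qsum-swap : ∀ {k m} (G : Fin k → Fin m → ℚ) →
    qsum (λ i → qsum (λ j → G i j)) ≡ qsum (λ j → qsum (λ i → G i j))
  qsum-swap {zero}  {m} G = sym (qsum-zero m)
  qsum-swap {suc k}     G = trans (cong (qsum (G zero) +_) (qsum-swap (G ∘ suc)))
    (sym (qsum-+ (G zero) (λ j → qsum (λ i → G (suc i) j))))

  qsum-nonNeg : ∀ {k} (f : Fin k → ℚ) → (∀ i → 0ℚ ≤ f i) → 0ℚ ≤ qsum f
  qsum-nonNeg {zero}  f 0≤f = ℚₚ.≤-refl
  qsum-nonNeg {suc k} f 0≤f = 0≤p+q (0≤f zero) (qsum-nonNeg (f ∘ suc) (0≤f ∘ suc))

  qsum-nonNeg-≡0 : ∀ {k} (f : Fin k → ℚ) → (∀ i → 0ℚ ≤ f i) → qsum f ≡ 0ℚ → ∀ i → f i ≡ 0ℚ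
  qsum-nonNeg-≡0 {suc k} f 0≤f sum≡0 zero =
    p+q≡0⇒p≡0 (0≤f zero) (qsum-nonNeg (f ∘ suc) (0≤f ∘ suc)) sum≡0
  qsum-nonNeg-≡0 {suc k} f 0≤f sum≡0 (suc i) =
    qsum-nonNeg-≡0 (f ∘ suc) (0≤f ∘ suc) (p+q≡0⇒q≡0 (0≤f zero) (qsum-nonNeg (f ∘ suc) (0≤f ∘ suc)) sum≡0) i

  qsum-++ : ∀ {m n} (f : Fin (m ℕ.+ n) → ℚ) → qsum f ≡ qsum (f ∘ (_↑ˡ n)) + qsum (f ∘ (m ↑ʳ_))
  qsum-++ {zero}      f = sym (ℚₚ.+-identityˡ (qsum f))
  qsum-++ {suc m} {n} f = trans (cong (f zero +_) (qsum-++ {m} {n} (f ∘ suc)))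
    (sym (ℚₚ.+-assoc (f zero) (qsum (f ∘ suc ∘ (_↑ˡ n))) (qsum (f ∘ suc ∘ (m ↑ʳ_)))))

  dot-++ : ∀ {m} (c d x y : Fin m → ℚ) → dot (c ++ d) (x ++ y) ≡ dot c x + dot d y
  dot-++ {m} c d x y = trans (qsum-++ {m} {m} _)
    (cong₂ _+_ (qsum-cong (λ j → cong₂ _*_ (lookup-++ˡ c d j) (lookup-++ˡ x y j)))
               (qsum-cong (λ j → cong₂ _*_ (lookup-++ʳ c d j) (lookup-++ʳ x y j))))

  point-↑ˡ : ∀ {r} (l m : Tuple r) J → point l m (J ↑ˡ r) ≡ ofℕ (l J)
  point-↑ˡ l m = lookup-++ˡ (ofℕ ∘ l) (ofℕ ∘ m)

  point-↑ʳ : ∀ {r} (l m : Tuple r) J → point l m (r ↑ʳ J) ≡ ofℕ (m J)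
  point-↑ʳ l m = lookup-++ʳ (ofℕ ∘ l) (ofℕ ∘ m)

  dot-cong : ∀ {d} (c : Pt d) {x y : Pt d} → (∀ i → x i ≡ y i) → dot c x ≡ dot c y
  dot-cong c x≗y = qsum-cong (λ i → cong (c i *_) (x≗y i))

  dot-0 : ∀ {d} (c : Pt d) → dot c (λ _ → 0ℚ) ≡ 0ℚ
  dot-0 {d} c = trans (qsum-cong (λ i → ℚₚ.*-zeroʳ (c i))) (qsum-zero d)

  dot-convex : ∀ {d k} (c : Pt d) (a : Fin k → ℚ) (g : Fin k → Pt d) {y : Pt d} →
    (∀ i → y i ≡ qsum (λ j → a j * g j i)) → dot c y ≡ qsum (λ j → a j * dot c (g j))
  dot-convex {d} {k} c a g {y} y≡ = begin
    qsum (λ i → c i * y i)                            ≡⟨ dot-cong c y≡ ⟩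
    qsum (λ i → c i * qsum (λ j → a j * g j i))       ≡⟨ qsum-cong (λ i → sym (qsum-*ˡ (c i) (λ j → a j * g j i))) ⟩
    qsum (λ i → qsum (λ j → c i * (a j * g j i)))     ≡⟨ qsum-swap (λ i j → c i * (a j * g j i)) ⟩
    qsum (λ j → qsum (λ i → c i * (a j * g j i)))
      ≡⟨ qsum-cong (λ j → trans (qsum-cong (λ i → commute (c i) (a j) (g j i))) (qsum-*ˡ (a j) (λ i → c i * g j i))) ⟩
    qsum (λ j → a j * dot c (g j))                    ∎
    where
    open ≡-Reasoning
    commute : ∀ x y z → x * (y * z) ≡ y * (x * z)
    commute = solve 3 (λ x y z → x :* (y :* z) := y :* (x :* z)) refl

  basis : ∀ {r} → ℕ → Fin r → ℚ
  basis zero    zero    = 1ℚ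
  basis zero    (suc j) = 0ℚ
  basis (suc k) zero    = 0ℚ
  basis (suc k) (suc j) = basis k j

  qsum-0* : ∀ {k} (f : Fin k → ℚ) → qsum (λ j → 0ℚ * f j) ≡ 0ℚ
  qsum-0* {k} f = trans (qsum-cong (λ j → ℚₚ.*-zeroˡ (f j))) (qsum-zero k)

  dot-basis : ∀ {r} k (l : Tuple r) → qsum (λ j → basis k j * ofℕ (l j)) ≡ ofℕ (parts l k)
  dot-basis {zero}  k       l = refl
  dot-basis {suc r} zero    l =
    trans (cong₂ _+_ (ℚₚ.*-identityˡ (ofℕ (l zero))) (qsum-0* (ofℕ ∘ l ∘ suc))) (ℚₚ.+-identityʳ _)
  dot-basis {suc r} (suc k) l =
    trans (cong₂ _+_ (ℚₚ.*-zeroˡ (ofℕ (l zero))) (dot-basis k (l ∘ suc))) (ℚₚ.+-identityˡ _)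

  indicator : ∀ {r} → List ℕ → Fin r → ℚ
  indicator []       j = 0ℚ
  indicator (k ∷ ks) j = basis k j + indicator ks j

  dot-indicator : ∀ {r} ks (l : Tuple r) → qsum (λ j → indicator ks j * ofℕ (l j)) ≡ ofℕ (sumAt (parts l) ks)
  dot-indicator []       l = qsum-0* (ofℕ ∘ l)
  dot-indicator (k ∷ ks) l = begin
    qsum (λ j → (basis k j + indicator ks j) * ofℕ (l j))
      ≡⟨ qsum-cong (λ j → ℚₚ.*-distribʳ-+ (ofℕ (l j)) (basis k j) (indicator ks j)) ⟩
    qsum (λ j → basis k j * ofℕ (l j) + indicator ks j * ofℕ (l j))
      ≡⟨ qsum-+ (λ j → basis k j * ofℕ (l j)) (λ j → indicator ks j * ofℕ (l j)) ⟩
    qsum (λ j → basis k j * ofℕ (l j)) + qsum (λ j → indicator ks j * ofℕ (l j))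
      ≡⟨ cong₂ _+_ (dot-basis k l) (dot-indicator ks l) ⟩
    ofℕ (parts l k) + ofℕ (sumAt (parts l) ks)
      ≡⟨ ofℕ-homo-+ (parts l k) (sumAt (parts l) ks) ⟨
    ofℕ (sumAt (parts l) (k ∷ ks)) ∎
    where open ≡-Reasoning

  stairGap : List ℕ → (ℕ → ℕ) → ℚ
  stairGap ds g = ofℕ (sumAt g (tops ds)) - ofℕ (sumAt g (bottoms ds))

  stairGap-nonNeg : ∀ ds {g} → Antitone g → 0ℚ ≤ stairGap ds g
  stairGap-nonNeg ds anti = p≤q⇒0≤q-p (ofℕ-mono-≤ (bottoms≤tops ds anti))

  stairGap≡0⇒Stair : ∀ ds {g} → Antitone g → stairGap ds g ≡ 0ℚ → Stair ds g
  stairGap≡0⇒Stair ds anti gap≡0 = tops≡bottoms⇒Stair ds anti (ofℕ-injective (p-q≡0⇒p≡q gap≡0))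

  Stair⇒stairGap≡0 : ∀ ds {g} → Stair ds g → stairGap ds g ≡ 0ℚ
  Stair⇒stairGap≡0 ds {g} stair =
    trans (cong (_- ofℕ (sumAt g (bottoms ds))) (cong ofℕ (Stair⇒tops≡bottoms ds stair)))
          (ℚₚ.+-inverseʳ (ofℕ (sumAt g (bottoms ds))))

  stairFunctional : ∀ {r} → List ℕ → Fin r → ℚ
  stairFunctional ds j = indicator (tops ds) j - indicator (bottoms ds) j

  dot-stairFunctional : ∀ {r} ds (l : Tuple r) →
    qsum (λ j → stairFunctional ds j * ofℕ (l j)) ≡ stairGap ds (parts l)
  dot-stairFunctional {r} ds l = begin
    qsum (λ j → (t j - b j) * y j)        ≡⟨ qsum-cong (λ j → ℚₚ.*-distribʳ-+ (y j) (t j) (- b j)) ⟩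
    qsum (λ j → t j * y j + - b j * y j)  ≡⟨ qsum-+ (λ j → t j * y j) (λ j → - b j * y j) ⟩
    qsum (λ j → t j * y j) + qsum (λ j → - b j * y j)
      ≡⟨ cong (qsum (λ j → t j * y j) +_)
           (trans (qsum-cong (λ j → sym (ℚₚ.neg-distribˡ-* (b j) (y j)))) (qsum-neg (λ j → b j * y j))) ⟩
    qsum (λ j → t j * y j) - qsum (λ j → b j * y j)
      ≡⟨ cong₂ _-_ (dot-indicator (tops ds) l) (dot-indicator (bottoms ds) l) ⟩
    stairGap ds (parts l) ∎
    where
    open ≡-Reasoning
    t b y : Fin r → ℚ
    t = indicator (tops ds)
    b = indicator (bottoms ds)
    y = ofℕ ∘ l

  faceFunctional : ∀ {r} → List ℕ → List ℕ → Pt (r ℕ.+ r)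
  faceFunctional {r} dsL dsR = stairFunctional {r} dsL ++ stairFunctional dsR

  dot-faceFunctional : ∀ {r} dsL dsR (l m : Tuple r) →
    dot (faceFunctional {r} dsL dsR) (point l m) ≡ stairGap dsL (parts l) + stairGap dsR (parts m)
  dot-faceFunctional {r} dsL dsR l m =
    trans (dot-++ {r} (stairFunctional dsL) (stairFunctional dsR) (ofℕ ∘ l) (ofℕ ∘ m))
          (cong₂ _+_ (dot-stairFunctional dsL l) (dot-stairFunctional dsR m))


module _ where
  import Data.Nat as ℕ
  import Data.Nat.Properties as ℕₚ
  open import Data.Rational using (_+_; _*_; _-_; -_; _≤_)
  open import Data.Rational.Solver using (module +-*-Solver)
  open +-*-Solver using (solve; _:+_; _:*_; _:-_; :-_; _:=_; con)
  open import Data.Vec.Functional using ([]; _∷_)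
  open GroupProperties ℚₚ.+-0-group using (⁻¹-injective; x≈y⇒x∙y⁻¹≈ε)

  -p≡0⇒p≡0 : ∀ {p} → - p ≡ 0ℚ → p ≡ 0ℚ
  -p≡0⇒p≡0 -p≡0 = ⁻¹-injective -p≡0

  -- The cross product of u and w lies in the kernel, so the minor u₀ w₁ − u₁ w₀ vanishes; then
  -- (u₁, −u₀, 0) and (w₁, −w₀, 0) lie in it, forcing u₀ = w₀ = 0, and then so does (1, 0, 0).
  2×3-kernel-nontrivial : ∀ (u w : Fin 3 → ℚ) →
    ¬ (∀ α → qsum (λ j → α j * u j) ≡ 0ℚ → qsum (λ j → α j * w j) ≡ 0ℚ → ∀ j → α j ≡ 0ℚ)
  2×3-kernel-nontrivial u w trivial =
    1≢0 (trivial (1ℚ ∷ 0ℚ ∷ 0ℚ ∷ []) (first-coordinate u u₀≡0) (first-coordinate w w₀≡0) zero)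
    where
    u₀ u₁ u₂ w₀ w₁ w₂ : ℚ
    u₀ = u zero ; u₁ = u (suc zero) ; u₂ = u (suc (suc zero))
    w₀ = w zero ; w₁ = w (suc zero) ; w₂ = w (suc (suc zero))
    1≢0 : 1ℚ ≢ 0ℚ
    1≢0 ()
    cross : Fin 3 → ℚ
    cross = (u₁ * w₂ - u₂ * w₁) ∷ (u₂ * w₀ - u₀ * w₂) ∷ (u₀ * w₁ - u₁ * w₀) ∷ []
    minor≡0 : u₀ * w₁ ≡ u₁ * w₀
    minor≡0 = p-q≡0⇒p≡q (trivial cross
      (solve 6 (λ u₀ u₁ u₂ w₀ w₁ w₂ →
         (u₁ :* w₂ :- u₂ :* w₁) :* u₀ :+ ((u₂ :* w₀ :- u₀ :* w₂) :* u₁ :+ ((u₀ :* w₁ :- u₁ :* w₀) :* u₂ :+ con 0ℚ))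
           := con 0ℚ) refl u₀ u₁ u₂ w₀ w₁ w₂)
      (solve 6 (λ u₀ u₁ u₂ w₀ w₁ w₂ →
         (u₁ :* w₂ :- u₂ :* w₁) :* w₀ :+ ((u₂ :* w₀ :- u₀ :* w₂) :* w₁ :+ ((u₀ :* w₁ :- u₁ :* w₀) :* w₂ :+ con 0ℚ))
           := con 0ℚ) refl u₀ u₁ u₂ w₀ w₁ w₂)
      (suc (suc zero)))
    u₀≡0 : u₀ ≡ 0ℚ
    u₀≡0 = -p≡0⇒p≡0 (trivial (u₁ ∷ - u₀ ∷ 0ℚ ∷ [])
      (solve 3 (λ u₀ u₁ u₂ → u₁ :* u₀ :+ ((:- u₀) :* u₁ :+ (con 0ℚ :* u₂ :+ con 0ℚ)) := con 0ℚ) refl u₀ u₁ u₂)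
      (trans (solve 5 (λ u₀ u₁ w₀ w₁ w₂ →
                u₁ :* w₀ :+ ((:- u₀) :* w₁ :+ (con 0ℚ :* w₂ :+ con 0ℚ)) := u₁ :* w₀ :- u₀ :* w₁) refl u₀ u₁ w₀ w₁ w₂)
             (x≈y⇒x∙y⁻¹≈ε (sym minor≡0)))
      (suc zero))
    w₀≡0 : w₀ ≡ 0ℚ
    w₀≡0 = -p≡0⇒p≡0 (trivial (w₁ ∷ - w₀ ∷ 0ℚ ∷ [])
      (trans (solve 5 (λ u₀ u₁ u₂ w₀ w₁ →
                w₁ :* u₀ :+ ((:- w₀) :* u₁ :+ (con 0ℚ :* u₂ :+ con 0ℚ)) := u₀ :* w₁ :- u₁ :* w₀) refl u₀ u₁ u₂ w₀ w₁)
             (x≈y⇒x∙y⁻¹≈ε minor≡0))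
      (solve 3 (λ w₀ w₁ w₂ → w₁ :* w₀ :+ ((:- w₀) :* w₁ :+ (con 0ℚ :* w₂ :+ con 0ℚ)) := con 0ℚ) refl w₀ w₁ w₂)
      (suc zero))
    first-coordinate : ∀ (x : Fin 3 → ℚ) → x zero ≡ 0ℚ → qsum (λ j → (1ℚ ∷ 0ℚ ∷ 0ℚ ∷ []) j * x j) ≡ 0ℚ
    first-coordinate x x₀≡0 = trans
      (solve 3 (λ x₀ x₁ x₂ → con 1ℚ :* x₀ :+ (con 0ℚ :* x₁ :+ (con 0ℚ :* x₂ :+ con 0ℚ)) := x₀) refl
        (x zero) (x (suc zero)) (x (suc (suc zero))))
      x₀≡0

  module _ {d : ℕ} (A : ℚ) (P Q : Pt d) (i₀ i₁ : Fin d) where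

    record InPlane (y : Pt d) : Set where
      constructor inPlane
      field onPlane : ∀ i → A * y i ≡ P i * y i₀ + Q i * y i₁

    open InPlane public

    inPlane-cong : ∀ {x y} → (∀ i → x i ≡ y i) → InPlane x → InPlane y
    inPlane-cong x≗y x∈ = inPlane λ i →
      subst₂ (λ s t → A * s ≡ P i * t + Q i * _) (x≗y i) (x≗y i₀)
        (subst (λ t → A * _ ≡ P i * _ + Q i * t) (x≗y i₁) (onPlane x∈ i))

    inPlane-lincomb : ∀ {k} (α : Fin k → ℚ) (v : Fin k → Pt d) →
      (∀ j → α j ≡ 0ℚ ⊎ InPlane (v j)) → InPlane (λ i → qsum (λ j → α j * v j i))
    inPlane-lincomb {k} α v αv = inPlane λ i → begin
      A * qsum (λ j → α j * v j i)                            ≡⟨ qsum-*ˡ A (λ j → α j * v j i) ⟨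
      qsum (λ j → A * (α j * v j i))                          ≡⟨ qsum-cong term ⟩
      qsum (λ j → P i * (α j * v j i₀) + Q i * (α j * v j i₁))
        ≡⟨ qsum-+ (λ j → P i * (α j * v j i₀)) (λ j → Q i * (α j * v j i₁)) ⟩
      qsum (λ j → P i * (α j * v j i₀)) + qsum (λ j → Q i * (α j * v j i₁))
        ≡⟨ cong₂ _+_ (qsum-*ˡ (P i) (λ j → α j * v j i₀)) (qsum-*ˡ (Q i) (λ j → α j * v j i₁)) ⟩
      P i * qsum (λ j → α j * v j i₀) + Q i * qsum (λ j → α j * v j i₁) ∎
      where
      open ≡-Reasoning
      term : ∀ {i} j → A * (α j * v j i) ≡ P i * (α j * v j i₀) + Q i * (α j * v j i₁)
      term {i} j with αv j
      ... | inj₁ αj≡0 rewrite αj≡0 =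
        solve 6 (λ A P Q x y z → A :* (con 0ℚ :* x) := P :* (con 0ℚ :* y) :+ Q :* (con 0ℚ :* z))
          refl A (P i) (Q i) (v j i) (v j i₀) (v j i₁)
      ... | inj₂ vj∈ = begin
        A * (α j * v j i)
          ≡⟨ solve 3 (λ A a x → A :* (a :* x) := a :* (A :* x)) refl A (α j) (v j i) ⟩
        α j * (A * v j i)
          ≡⟨ cong (α j *_) (onPlane vj∈ i) ⟩
        α j * (P i * v j i₀ + Q i * v j i₁)
          ≡⟨ solve 5 (λ a P x Q y → a :* (P :* x :+ Q :* y) := P :* (a :* x) :+ Q :* (a :* y))
               refl (α j) (P i) (v j i₀) (Q i) (v j i₁) ⟩
        P i * (α j * v j i₀) + Q i * (α j * v j i₁)
          ∎

    inPlane-- : ∀ {x y} → InPlane x → InPlane y → InPlane (λ i → x i - y i)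
    inPlane-- {x} {y} x∈ y∈ = inPlane λ i → begin
      A * (x i - y i)
        ≡⟨ solve 3 (λ A x y → A :* (x :- y) := A :* x :- A :* y) refl A (x i) (y i) ⟩
      A * x i - A * y i
        ≡⟨ cong₂ _-_ (onPlane x∈ i) (onPlane y∈ i) ⟩
      (P i * x i₀ + Q i * x i₁) - (P i * y i₀ + Q i * y i₁)
        ≡⟨ solve 6 (λ P Q a b c e → (P :* a :+ Q :* b) :- (P :* c :+ Q :* e) := P :* (a :- c) :+ Q :* (b :- e))
             refl (P i) (Q i) (x i₀) (x i₁) (y i₀) (y i₁) ⟩
      P i * (x i₀ - y i₀) + Q i * (x i₁ - y i₁)
        ∎
      where open ≡-Reasoning

    inPlane⇒¬AffIndep : A ≢ 0ℚ → (p : Fin 4 → Pt d) → (∀ j → InPlane (p j)) → ¬ AffIndep p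
    inPlane⇒¬AffIndep A≢0 p p∈ independent =
      2×3-kernel-nontrivial (λ j → v j i₀) (λ j → v j i₁) λ α αv₀≡0 αv₁≡0 →
        independent α λ i → p*q≡0⇒q≡0 A≢0 (begin
          A * qsum (λ j → α j * v j i)
            ≡⟨ onPlane (inPlane-lincomb α v (λ j → inj₂ (inPlane-- (p∈ (suc j)) (p∈ zero)))) i ⟩
          P i * qsum (λ j → α j * v j i₀) + Q i * qsum (λ j → α j * v j i₁)
            ≡⟨ cong₂ (λ s t → P i * s + Q i * t) αv₀≡0 αv₁≡0 ⟩
          P i * 0ℚ + Q i * 0ℚ
            ≡⟨ solve 2 (λ P Q → P :* con 0ℚ :+ Q :* con 0ℚ := con 0ℚ) refl (P i) (Q i) ⟩
          0ℚ
            ∎)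
      where
      open ≡-Reasoning
      v : Fin 3 → Pt d
      v j i = p (suc j) i - p zero i

  triangle : ∀ {d} → Pt d → Pt d → Fin 3 → Pt d
  triangle x u = (λ _ → 0ℚ) ∷ x ∷ u ∷ []

  triangle-AffIndep : ∀ {d} (x u : Pt d) i₀ i₁ → x i₀ * u i₁ ≢ x i₁ * u i₀ → AffIndep (triangle x u)
  triangle-AffIndep x u i₀ i₁ det≢0 α α-kernel = λ where
      zero       → p*q≡0⇒q≡0 det'≢0 (begin
        (x₀ * u₁ - x₁ * u₀) * a₀  ≡⟨ solve 6 (λ x₀ x₁ u₀ u₁ a₀ a₁ → (x₀ :* u₁ :- x₁ :* u₀) :* a₀
                                        := u₁ :* E x₀ u₀ a₀ a₁ :- u₀ :* E x₁ u₁ a₀ a₁)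
                                    refl x₀ x₁ u₀ u₁ a₀ a₁ ⟩
        u₁ * e₀ - u₀ * e₁         ≡⟨ cong₂ (λ e f → u₁ * e - u₀ * f) (α-kernel i₀) (α-kernel i₁) ⟩
        u₁ * 0ℚ - u₀ * 0ℚ         ≡⟨ solve 2 (λ s t → s :* con 0ℚ :- t :* con 0ℚ := con 0ℚ) refl u₁ u₀ ⟩
        0ℚ                        ∎)
      (suc zero) → p*q≡0⇒q≡0 det'≢0 (begin
        (x₀ * u₁ - x₁ * u₀) * a₁  ≡⟨ solve 6 (λ x₀ x₁ u₀ u₁ a₀ a₁ → (x₀ :* u₁ :- x₁ :* u₀) :* a₁
                                        := x₀ :* E x₁ u₁ a₀ a₁ :- x₁ :* E x₀ u₀ a₀ a₁)
                                    refl x₀ x₁ u₀ u₁ a₀ a₁ ⟩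
        x₀ * e₁ - x₁ * e₀         ≡⟨ cong₂ (λ e f → x₀ * e - x₁ * f) (α-kernel i₁) (α-kernel i₀) ⟩
        x₀ * 0ℚ - x₁ * 0ℚ         ≡⟨ solve 2 (λ s t → s :* con 0ℚ :- t :* con 0ℚ := con 0ℚ) refl x₀ x₁ ⟩
        0ℚ                        ∎)
    where
    open ≡-Reasoning
    x₀ x₁ u₀ u₁ a₀ a₁ e₀ e₁ : ℚ
    x₀ = x i₀ ; x₁ = x i₁ ; u₀ = u i₀ ; u₁ = u i₁ ; a₀ = α zero ; a₁ = α (suc zero)
    E : ∀ {n} → (x u a₀ a₁ : +-*-Solver.Polynomial n) → +-*-Solver.Polynomial n
    E x u a₀ a₁ = a₀ :* (x :- con 0ℚ) :+ (a₁ :* (u :- con 0ℚ) :+ con 0ℚ)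
    e₀ = a₀ * (x₀ - 0ℚ) + (a₁ * (u₀ - 0ℚ) + 0ℚ)
    e₁ = a₀ * (x₁ - 0ℚ) + (a₁ * (u₁ - 0ℚ) + 0ℚ)
    det'≢0 : x₀ * u₁ - x₁ * u₀ ≢ 0ℚ
    det'≢0 = det≢0 ∘ p-q≡0⇒p≡q

  IsGen⇒InKostka : ∀ {r} x → IsGen r x → InKostka r x
  IsGen⇒InKostka x gen =
    1 , (λ _ → 1ℚ) , (λ _ → x) , (λ _ → ℚₚ.nonNegative⁻¹ 1ℚ) , ℚₚ.+-identityʳ 1ℚ , (λ _ → gen) ,
    λ i → sym (trans (ℚₚ.+-identityʳ (1ℚ * x i)) (ℚₚ.*-identityˡ (x i)))

  0-IsGen : ∀ r → IsGen r (λ _ → 0ℚ)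
  0-IsGen r = 0 , zeros , zeros , zeros-Par , zeros-Par , (λ k _ → ℕₚ.≤-refl) , zeros-point
    where
    zeros : Tuple r
    zeros _ = 0
    zeros-Par : Par r 0 zeros
    zeros-Par = tabulate-Par {g = λ _ → 0} (λ _ → ℕₚ.≤-refl) (partialSum-zero r (λ _ → refl))
    zeros-point : ∀ i → 0ℚ ≡ point zeros zeros i
    zeros-point i with splitAt r i
    ... | inj₁ _ = refl
    ... | inj₂ _ = refl

  module _ {r} (c : Pt (r ℕ.+ r)) (gen-nonNeg : ∀ y → IsGen r y → 0ℚ ≤ dot c y) where

    InKostka⇒nonNeg : ∀ y → InKostka r y → 0ℚ ≤ dot c y
    InKostka⇒nonNeg y (k , a , g , 0≤a , _ , gen , y≡) =
      subst (0ℚ ≤_) (sym (dot-convex c a g y≡))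
        (qsum-nonNeg _ (λ j → 0≤p*q (0≤a j) (gen-nonNeg (g j) (gen j))))

    face⇒InPlane : ∀ {A P Q i₀ i₁} → (∀ y → IsGen r y → dot c y ≡ 0ℚ → InPlane A P Q i₀ i₁ y) →
      ∀ y → InKostka r y → dot c y ≡ 0ℚ → InPlane A P Q i₀ i₁ y
    face⇒InPlane {A} {P} {Q} {i₀} {i₁} gen-plane y (k , a , g , 0≤a , _ , gen , y≡) cy≡0 =
      inPlane-cong A P Q i₀ i₁ (λ i → sym (y≡ i)) (inPlane-lincomb A P Q i₀ i₁ a g supported)
      where
      terms≡0 : ∀ j → a j * dot c (g j) ≡ 0ℚ
      terms≡0 = qsum-nonNeg-≡0 _ (λ j → 0≤p*q (0≤a j) (gen-nonNeg (g j) (gen j)))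
                  (trans (sym (dot-convex c a g y≡)) cy≡0)
      supported : ∀ j → a j ≡ 0ℚ ⊎ InPlane A P Q i₀ i₁ (g j)
      supported j with a j ℚₚ.≟ 0ℚ
      ... | yes aj≡0 = inj₁ aj≡0
      ... | no  aj≢0 = inj₂ (gen-plane (g j) (gen j) (p*q≡0⇒q≡0 aj≢0 (terms≡0 j)))

    onFaceOfDim₂ : ∀ A P Q i₀ i₁ → A ≢ 0ℚ →
      (∀ y → IsGen r y → dot c y ≡ 0ℚ → InPlane A P Q i₀ i₁ y) →
      ∀ x u → IsGen r x → IsGen r u → dot c x ≡ 0ℚ → dot c u ≡ 0ℚ → x i₀ * u i₁ ≢ x i₁ * u i₀ →
      OnFaceOfDim r 2 x
    onFaceOfDim₂ A P Q i₀ i₁ A≢0 gen-plane x u x-gen u-gen cx≡0 cu≡0 det≢0 =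
      c , 0ℚ , InKostka⇒nonNeg , (IsGen⇒InKostka x x-gen , cx≡0) ,
      (triangle x u , corners , triangle-AffIndep x u i₀ i₁ det≢0) ,
      λ p p∈face → inPlane⇒¬AffIndep A P Q i₀ i₁ A≢0 p
        (λ j → face⇒InPlane {A} {P} {Q} {i₀} {i₁} gen-plane (p j) (proj₁ (p∈face j)) (proj₂ (p∈face j)))
      where
      corners : ∀ j → FaceOf r c 0ℚ (triangle x u j)
      corners zero             = IsGen⇒InKostka _ (0-IsGen r) , dot-0 c
      corners (suc zero)       = IsGen⇒InKostka x x-gen , cx≡0
      corners (suc (suc zero)) = IsGen⇒InKostka u u-gen , cu≡0


module _ where
  open import Data.Nat using (_+_; _*_; _≤_)
  open import Data.Nat.Properties
  open import Data.List using (List; []; _∷_)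
  open import Data.Vec.Functional using (_++_)

  module _ {r : ℕ} (dsL dsR : List ℕ) where

    faceFunctional-nonNeg : ∀ y → IsGen r y → 0ℚ ℚ.≤ dot (faceFunctional {r} dsL dsR) y
    faceFunctional-nonNeg y (n , l , m , pl , pm , _ , y≡) =
      subst (0ℚ ℚ.≤_) (sym (trans (dot-cong (faceFunctional {r} dsL dsR) y≡) (dot-faceFunctional dsL dsR l m)))
        (0≤p+q (stairGap-nonNeg dsL (Par⇒antitone pl)) (stairGap-nonNeg dsR (Par⇒antitone pm)))

    faceFunctional≡0⇒Stair : ∀ {n} {l m : Tuple r} → Par r n l → Par r n m →
      dot (faceFunctional {r} dsL dsR) (point l m) ≡ 0ℚ → Stair dsL (parts l) × Stair dsR (parts m)
    faceFunctional≡0⇒Stair {l = l} {m} pl pm c≡0 =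
      stairGap≡0⇒Stair dsL (Par⇒antitone pl) (p+q≡0⇒p≡0 gapL≥0 gapR≥0 gaps≡0) ,
      stairGap≡0⇒Stair dsR (Par⇒antitone pm) (p+q≡0⇒q≡0 gapL≥0 gapR≥0 gaps≡0)
      where
      gapL≥0 : 0ℚ ℚ.≤ stairGap dsL (parts l)
      gapL≥0 = stairGap-nonNeg dsL (Par⇒antitone pl)
      gapR≥0 : 0ℚ ℚ.≤ stairGap dsR (parts m)
      gapR≥0 = stairGap-nonNeg dsR (Par⇒antitone pm)
      gaps≡0 : stairGap dsL (parts l) ℚ.+ stairGap dsR (parts m) ≡ 0ℚ
      gaps≡0 = trans (sym (dot-faceFunctional dsL dsR l m)) c≡0

    Stair⇒faceFunctional≡0 : ∀ (l m : Tuple r) → Stair dsL (parts l) → Stair dsR (parts m) →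
      dot (faceFunctional {r} dsL dsR) (point l m) ≡ 0ℚ
    Stair⇒faceFunctional≡0 l m stairL stairR =
      trans (dot-faceFunctional dsL dsR l m)
        (cong₂ ℚ._+_ (Stair⇒stairGap≡0 dsL stairL) (Stair⇒stairGap≡0 dsR stairR))

    staircaseFace₂ : ∀ A P Q i₀ i₁ → A ≢ 0ℚ →
      (∀ {n} {l m : Tuple r} → Par r n l → Par r n m →
        Stair dsL (parts l) × Stair dsR (parts m) → InPlane A P Q i₀ i₁ (point l m)) →
      ∀ {n n'} {l m l' m' : Tuple r} →
      Par r n l → Par r n m → Dominates l m → Stair dsL (parts l) → Stair dsR (parts m) →
      Par r n' l' → Par r n' m' → Dominates l' m' → Stair dsL (parts l') → Stair dsR (parts m') →
      point l m i₀ ℚ.* point l' m' i₁ ≢ point l m i₁ ℚ.* point l' m' i₀ → OnFaceOfDim r 2 (point l m)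
    staircaseFace₂ A P Q i₀ i₁ A≢0 stairs⇒InPlane {n} {n'} {l} {m} {l'} {m'}
      pl pm dom stairL stairM pl' pm' dom' stairL' stairM' det≢0 =
      onFaceOfDim₂ C faceFunctional-nonNeg A P Q i₀ i₁ A≢0 face-plane (point l m) (point l' m')
        (n , l , m , pl , pm , dom , λ _ → refl) (n' , l' , m' , pl' , pm' , dom' , λ _ → refl)
        (Stair⇒faceFunctional≡0 l m stairL stairM) (Stair⇒faceFunctional≡0 l' m' stairL' stairM') det≢0
      where
      C : Pt (r + r)
      C = faceFunctional {r} dsL dsR
      face-plane : ∀ y → IsGen r y → dot C y ≡ 0ℚ → InPlane A P Q i₀ i₁ y
      face-plane y (_ , l″ , m″ , pl″ , pm″ , _ , y≡) Cy≡0 =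
        inPlane-cong A P Q i₀ i₁ (λ i → sym (y≡ i))
          (stairs⇒InPlane pl″ pm″ (faceFunctional≡0⇒Stair pl″ pm″ (trans (sym (dot-cong C y≡)) Cy≡0)))

  embed : ∀ {r} → (ℕ → ℕ) → Fin r → ℚ
  embed f J = ofℕ (f (toℕ J))

  point-InPlane : ∀ {r} (A : ℕ) (PL QL PR QR : ℕ → ℕ) {q s} {l m : Tuple r} {i₀ i₁} →
    (∀ j → A * parts l j ≡ PL j * q + QL j * s) →
    (∀ j → A * parts m j ≡ PR j * q + QR j * s) →
    point l m i₀ ≡ ofℕ q → point l m i₁ ≡ ofℕ s →
    InPlane (ofℕ A) (embed {r} PL ++ embed {r} PR) (embed {r} QL ++ embed {r} QR) i₀ i₁ (point l m)
  point-InPlane {r} A PL QL PR QR {q} {s} {l} {m} l-rep m-rep x₀≡q x₁≡s = inPlane λ i →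
    subst₂ (λ x₀ x₁ → ofℕ A ℚ.* point l m i ≡ P i ℚ.* x₀ ℚ.+ Q i ℚ.* x₁)
      (sym x₀≡q) (sym x₁≡s) (coordinate i)
    where
    P Q : Pt (r + r)
    P = embed {r} PL ++ embed {r} PR
    Q = embed {r} QL ++ embed {r} QR
    entry : ∀ (t : Tuple r) PT QT → (∀ j → A * parts t j ≡ PT j * q + QT j * s) →
      ∀ J → ofℕ A ℚ.* ofℕ (t J) ≡ embed PT J ℚ.* ofℕ q ℚ.+ embed QT J ℚ.* ofℕ s
    entry t PT QT t-rep J = ofℕ-linear A (t J) (PT (toℕ J)) q (QT (toℕ J)) s
      (trans (cong (A *_) (sym (parts-toℕ t J))) (t-rep (toℕ J)))
    coordinate : ∀ i → ofℕ A ℚ.* point l m i ≡ P i ℚ.* ofℕ q ℚ.+ Q i ℚ.* ofℕ s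
    coordinate i with splitAt r i
    ... | inj₁ J = entry l PL QL l-rep J
    ... | inj₂ J = entry m PR QR m-rep J

  point-parts-↑ˡ : ∀ {r k} (l m : Tuple r) (k<r : k < r) → point l m (fromℕ< k<r ↑ˡ r) ≡ ofℕ (parts l k)
  point-parts-↑ˡ l m k<r = trans (point-↑ˡ l m _) (cong ofℕ (sym (parts-fromℕ< l k<r)))

  point-parts-↑ʳ : ∀ {r k} (l m : Tuple r) (k<r : k < r) → point l m (r ↑ʳ fromℕ< k<r) ≡ ofℕ (parts m k)
  point-parts-↑ʳ l m k<r = trans (point-↑ʳ l m _) (cong ofℕ (sym (parts-fromℕ< m k<r)))

  -- The rectangle (p^a) and the partition (q^b, s^c) with q = parts 0, s = parts b; the marks ˡ and
  -- ʳ say whether the rectangle is the left or the right partition of the point.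
  module RectangleAndTwoSizes {r : ℕ} (a b c : ℕ) (0<a : 0 < a) (0<c : 0 < c) (a≤r : a ≤ r) (b+c≤r : b + c ≤ r) where

    rectQ rectS twoQ twoS : ℕ → ℕ
    rectQ = rectangle a b
    rectS = rectangle a c
    twoQ  = staircase (b ∷ c ∷ []) (a ∷ 0 ∷ [])
    twoS  = staircase (b ∷ c ∷ []) (0 ∷ a ∷ [])

    Pˡ Qˡ Pʳ Qʳ : Pt (r + r)
    Pˡ = embed {r} rectQ ++ embed {r} twoQ
    Qˡ = embed {r} rectS ++ embed {r} twoS
    Pʳ = embed {r} twoQ ++ embed {r} rectQ
    Qʳ = embed {r} twoS ++ embed {r} rectS

    rect-rep : ∀ {o t : ℕ → ℕ} → Stair (a ∷ []) o → Stair (b ∷ c ∷ []) t → partialSum o r ≡ partialSum t r →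
      ∀ j → a * o j ≡ rectQ j * t 0 + rectS j * t b
    rect-rep {o} {t} stairO stairT sums≡ j = begin
      a * o j                                    ≡⟨ cong (a *_) (Stair⇒staircase (a ∷ []) stairO j) ⟩
      a * staircase (a ∷ []) (o 0 ∷ []) j
        ≡⟨ staircase-zipWith (λ h _ → a * h) (*-zeroʳ a) (a ∷ []) (o 0 ∷ []) (o 0 ∷ []) refl j ⟨
      staircase (a ∷ []) (a * o 0 ∷ []) j        ≡⟨ cong (λ h → staircase (a ∷ []) (h ∷ []) j) size ⟩
      staircase (a ∷ []) (b * t 0 + c * t b ∷ []) j
        ≡⟨ staircase-zipWith (λ h h' → h * t 0 + h' * t b) refl (a ∷ []) (b ∷ []) (c ∷ []) refl j ⟩
      rectQ j * t 0 + rectS j * t b              ∎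
      where
      open ≡-Reasoning
      size : a * o 0 ≡ b * t 0 + c * t b
      size = begin
        a * o 0                         ≡⟨ +-identityʳ (a * o 0) ⟨
        a * o 0 + 0                     ≡⟨ partialSum-Stair (a ∷ []) stairO (≤-trans (≤-reflexive (+-identityʳ a)) a≤r) ⟨
        partialSum o r                  ≡⟨ sums≡ ⟩
        partialSum t r
          ≡⟨ partialSum-Stair (b ∷ c ∷ []) stairT (≤-trans (≤-reflexive (cong (b +_) (+-identityʳ c))) b+c≤r) ⟩
        b * t 0 + (c * t (b + 0) + 0)
          ≡⟨ cong (λ x → b * t 0 + x) (trans (+-identityʳ _) (cong (λ i → c * t i) (+-identityʳ b))) ⟩
        b * t 0 + c * t b               ∎

    two-rep : ∀ {t : ℕ → ℕ} → Stair (b ∷ c ∷ []) t → ∀ j → a * t j ≡ twoQ j * t 0 + twoS j * t b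
    two-rep {t} stairT j = begin
      a * t j                                                   ≡⟨ cong (a *_) (Stair⇒staircase (b ∷ c ∷ []) stairT j) ⟩
      a * staircase (b ∷ c ∷ []) (t 0 ∷ s ∷ []) j
        ≡⟨ staircase-zipWith (λ h _ → a * h) (*-zeroʳ a) (b ∷ c ∷ []) (t 0 ∷ s ∷ []) (t 0 ∷ s ∷ []) refl j ⟨
      staircase (b ∷ c ∷ []) (a * t 0 ∷ a * s ∷ []) j
        ≡⟨ cong (λ h → staircase (b ∷ c ∷ []) (h ∷ a * s ∷ []) j) (+-identityʳ (a * t 0)) ⟨
      staircase (b ∷ c ∷ []) (a * t 0 + 0 * s ∷ 0 * t 0 + a * s ∷ []) j
        ≡⟨ staircase-zipWith (λ h h' → h * t 0 + h' * s) refl (b ∷ c ∷ []) (a ∷ 0 ∷ []) (0 ∷ a ∷ []) refl j ⟩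
      twoQ j * t 0 + twoS j * s                                 ≡⟨ cong (λ i → twoQ j * t 0 + twoS j * t i) (+-identityʳ b) ⟩
      twoQ j * t 0 + twoS j * t b                               ∎
      where
      open ≡-Reasoning
      s : ℕ
      s = t (b + 0)

    b<b+c : b < b + c
    b<b+c = subst (_< b + c) (+-identityʳ b) (+-monoʳ-< b 0<c)

    b<r : b < r
    b<r = <-≤-trans b<b+c b+c≤r

    0<b+c : 0 < b + c
    0<b+c = ≤-<-trans z≤n b<b+c

    0<r : 0 < r
    0<r = <-≤-trans 0<b+c b+c≤r

    -- Together with 0 and the given point, the face contains the point with q = s = a.
    tall wide : Tuple r
    tall = rectangle a (b + c) ∘ toℕ
    wide = rectangle (b + c) a ∘ toℕ

    wide-Par : Par r (a * (b + c)) wide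
    wide-Par = subst (λ n → Par r n wide) (*-comm (b + c) a) (rectangle-Par (b + c) a b+c≤r)

    tall-Stair : Stair (a ∷ []) (parts tall)
    tall-Stair = Stair-cong (a ∷ []) (λ j → sym (parts-rectangle a (b + c) a≤r j))
      (staircase-Stair (a ∷ []) (b + c ∷ []) refl)

    wide-Stair : Stair (b ∷ c ∷ []) (parts wide)
    wide-Stair = Stair-cong (b ∷ c ∷ [])
      (λ j → trans (staircase-merge b c [] a [] j) (sym (parts-rectangle (b + c) a b+c≤r j)))
      (staircase-Stair (b ∷ c ∷ []) (a ∷ a ∷ []) refl)

    wide-< : ∀ {k} → k < b + c → parts wide k ≡ a
    wide-< k<b+c = trans (parts-rectangle (b + c) a b+c≤r _) (staircase-< (b + c) [] a [] k<b+c)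

    det≢0 : ∀ {d} (x u : Pt d) i₀ i₁ (t : ℕ → ℕ) → t 0 ≢ t b →
      x i₀ ≡ ofℕ (t 0) → x i₁ ≡ ofℕ (t b) → u i₀ ≡ ofℕ a → u i₁ ≡ ofℕ a →
      x i₀ ℚ.* u i₁ ≢ x i₁ ℚ.* u i₀
    det≢0 x u i₀ i₁ t q≢s x₀≡q x₁≡s u₀≡a u₁≡a eq =
      q≢s (ofℕ-*-cancelʳ (>⇒≢ 0<a)
        (trans (sym (cong₂ ℚ._*_ x₀≡q u₁≡a)) (trans eq (cong₂ ℚ._*_ x₁≡s u₀≡a))))

    ofℕa≢0 : ofℕ a ≢ 0ℚ
    ofℕa≢0 = >⇒≢ 0<a ∘ ofℕ-injective

    sizes≡ : ∀ {n} {l m : Tuple r} → Par r n l → Par r n m → partialSum (parts l) r ≡ partialSum (parts m) r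
    sizes≡ pl pm = trans (Par⇒partialSum pl) (sym (Par⇒partialSum pm))

    i₀ˡ i₁ˡ i₀ʳ i₁ʳ : Fin (r + r)
    i₀ˡ = r ↑ʳ fromℕ< 0<r
    i₁ˡ = r ↑ʳ fromℕ< b<r
    i₀ʳ = fromℕ< 0<r ↑ˡ r
    i₁ʳ = fromℕ< b<r ↑ˡ r

    rectangle-left-InPlane : ∀ {n} {l m : Tuple r} → Par r n l → Par r n m →
      Stair (a ∷ []) (parts l) × Stair (b ∷ c ∷ []) (parts m) → InPlane (ofℕ a) Pˡ Qˡ i₀ˡ i₁ˡ (point l m)
    rectangle-left-InPlane {l = l} {m} pl pm (stairL , stairM) =
      point-InPlane {r} a rectQ rectS twoQ twoS {l = l} {m} (rect-rep stairL stairM (sizes≡ pl pm)) (two-rep stairM)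
        (point-parts-↑ʳ l m 0<r) (point-parts-↑ʳ l m b<r)

    rectangle-left : ∀ {n} {l m : Tuple r} → Par r n l → Par r n m → Dominates l m →
      HasLength (parts l) a → HasLength (parts m) (b + c) → parts m 0 ≢ parts m b →
      Stair (a ∷ []) (parts l) → Stair (b ∷ c ∷ []) (parts m) → OnFaceOfDim r 2 (point l m)
    rectangle-left {l = l} {m} pl pm dom lenL lenM q≢s stairL stairM =
      staircaseFace₂ (a ∷ []) (b ∷ c ∷ []) (ofℕ a) Pˡ Qˡ i₀ˡ i₁ˡ ofℕa≢0 rectangle-left-InPlane
        pl pm dom stairL stairM
        (rectangle-Par a (b + c) a≤r) wide-Par (rectangle-Dominates (dominates⇒length≤ pl pm dom lenL lenM))
        tall-Stair wide-Stair
        (det≢0 (point l m) (point tall wide) i₀ˡ i₁ˡ (parts m) q≢s (point-parts-↑ʳ l m 0<r) (point-parts-↑ʳ l m b<r)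
          (trans (point-parts-↑ʳ tall wide 0<r) (cong ofℕ (wide-< 0<b+c)))
          (trans (point-parts-↑ʳ tall wide b<r) (cong ofℕ (wide-< b<b+c))))

    rectangle-right-InPlane : ∀ {n} {l m : Tuple r} → Par r n l → Par r n m →
      Stair (b ∷ c ∷ []) (parts l) × Stair (a ∷ []) (parts m) → InPlane (ofℕ a) Pʳ Qʳ i₀ʳ i₁ʳ (point l m)
    rectangle-right-InPlane {l = l} {m} pl pm (stairL , stairM) =
      point-InPlane {r} a twoQ twoS rectQ rectS {l = l} {m} (two-rep stairL) (rect-rep stairM stairL (sizes≡ pm pl))
        (point-parts-↑ˡ l m 0<r) (point-parts-↑ˡ l m b<r)

    rectangle-right : ∀ {n} {l m : Tuple r} → Par r n l → Par r n m → Dominates l m →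
      HasLength (parts l) (b + c) → HasLength (parts m) a → parts l 0 ≢ parts l b →
      Stair (b ∷ c ∷ []) (parts l) → Stair (a ∷ []) (parts m) → OnFaceOfDim r 2 (point l m)
    rectangle-right {l = l} {m} pl pm dom lenL lenM q≢s stairL stairM =
      staircaseFace₂ (b ∷ c ∷ []) (a ∷ []) (ofℕ a) Pʳ Qʳ i₀ʳ i₁ʳ ofℕa≢0 rectangle-right-InPlane
        pl pm dom stairL stairM
        wide-Par (rectangle-Par a (b + c) a≤r) (rectangle-Dominates (dominates⇒length≤ pl pm dom lenL lenM))
        wide-Stair tall-Stair
        (det≢0 (point l m) (point wide tall) i₀ʳ i₁ʳ (parts l) q≢s (point-parts-↑ˡ l m 0<r) (point-parts-↑ˡ l m b<r)
          (trans (point-parts-↑ˡ wide tall 0<r) (cong ofℕ (wide-< 0<b+c)))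
          (trans (point-parts-↑ˡ wide tall b<r) (cong ofℕ (wide-< b<b+c))))


lemma6p11 : (r n : ℕ) → 0 < r → 0 < n → (l m : Tuple r) →
    Par r n l → Par r n m → Dominates l m →
    ((Rectangular l × TwoPartSizes m) ⊎ (TwoPartSizes l × Rectangular m)) →
    OnFaceOfDim r 2 (point l m)
-- 0 < r follows from 0 < n.
lemma6p11 r n _ 0<n l m pl pm dom (inj₁ (rect , two))
  with Rectangular⇒Stair pl 0<n rect | TwoPartSizes⇒Stair pm two
... | a , 0<a , a≤r , lenL , stairL | b , c , 0<c , b+c≤r , lenM , q≢s , stairM =
  RectangleAndTwoSizes.rectangle-left a b c 0<a 0<c a≤r b+c≤r pl pm dom lenL lenM q≢s stairL stairM
lemma6p11 r n _ 0<n l m pl pm dom (inj₂ (two , rect))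
  with TwoPartSizes⇒Stair pl two | Rectangular⇒Stair pm 0<n rect
... | b , c , 0<c , b+c≤r , lenL , q≢s , stairL | a , 0<a , a≤r , lenM , stairM =
  RectangleAndTwoSizes.rectangle-right a b c 0<a 0<c a≤r b+c≤r pl pm dom lenL lenM q≢s stairL stairM
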